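{- For every $n\ge1$, $C_{2,n}=2^{n-1}$.
   Context: A binary tree is a rooted plane tree in which every node has $0$ or $2$ ordered children; $\mathcal T_n$ is the set of binary trees with $n+1$ leaves. For binary trees $s,t$, $s\wedge t$ has left subtree $s$ and right subtree $t$ at the root; iterated $\wedge$ is read left to right. For $k\ge1$, a right $k$-rotation replaces a maximal subtree $(t_0\wedge\cdots\wedge t_k)\wedge t_{k+1}$ by $t_0\wedge(t_1\wedge\cdots\wedge t_{k+1})$, and a left $k$-rotation is its inverse; $k$-equivalence classes of $\mathcal T_n$ are the classes of trees related by finite sequences of such rotations. $C_{k,n}$ denotes the number of $k$-equivalence classes of $\mathcal T_n$ (equivalently, of parenthesizations of $x_0*\cdots*x_n$ modulo $(x_0*\cdots*x_k)*x_{k+1}=x_0*(x_1*\cdots*x_{k+1})$). -}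

module Defs where

open import Data.Nat using (ℕ; zero; suc; _+_)
open import Data.List using (List; []; _∷_; _++_; [_]; length)
open import Data.Fin using (Fin)
open import Data.Product using (Σ; ∃; _×_; _,_; proj₁)
open import Function using (_⇔_)
open import Relation.Binary.PropositionalEquality using (_≡_)
open import Relation.Binary.Construct.Closure.Equivalence using (EqClosure)

data Tree : Set where
  leaf : Tree
  _∧_  : Tree → Tree → Tree

infixl 5 _∧_

leaves : Tree → ℕ
leaves leaf    = 1
leaves (s ∧ t) = leaves s + leaves t

𝒯 : ℕ → Set
𝒯 n = Σ Tree (λ t → leaves t ≡ suc n)

-- Iterated ∧ read left to right:  comb t₀ (t₁ ∷ … ∷ tₘ) = t₀ ∧ t₁ ∧ ⋯ ∧ tₘ
-- = ((t₀ ∧ t₁) ∧ ⋯) ∧ tₘ.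
comb : Tree → List Tree → Tree
comb t₀ []       = t₀
comb t₀ (t ∷ ts) = comb (t₀ ∧ t) ts

-- One right k-rotation (k ≥ 1), applied at any subtree:
--   (t₀ ∧ t₁ ∧ ⋯ ∧ t_k) ∧ t_{k+1}  ↦  t₀ ∧ (t₁ ∧ ⋯ ∧ t_{k+1}),
-- where us = t₂ … t_k has length k - 1.
data RightRot (k : ℕ) : Tree → Tree → Set where
  root  : (t₀ t₁ : Tree) (us : List Tree) (t' : Tree) →
          suc (length us) ≡ k →
          RightRot k (comb t₀ (t₁ ∷ us) ∧ t') (t₀ ∧ comb t₁ (us ++ [ t' ]))
  left  : ∀ {s s'} (t : Tree) → RightRot k s s' → RightRot k (s ∧ t) (s' ∧ t)
  right : ∀ {t t'} (s : Tree) → RightRot k t t' → RightRot k (s ∧ t) (s ∧ t')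

-- k-equivalence: trees related by finite sequences of right/left k-rotations
-- (left rotations are inverses of right ones): the equivalence closure.
_≈[_]_ : Tree → ℕ → Tree → Set
s ≈[ k ] t = EqClosure (RightRot k) s t

-- "𝒯 n has exactly c k-equivalence classes": there is a map from 𝒯 n onto
-- Fin c whose fibres are exactly the k-equivalence classes.
HasClassCount : ℕ → ℕ → ℕ → Set
HasClassCount k n c =
  Σ (𝒯 n → Fin c) λ cls →
    ((i : Fin c) → ∃ λ t → cls t ≡ i) ×
    ((s t : 𝒯 n) → (cls s ≡ cls t) ⇔ (proj₁ s ≈[ k ] proj₁ t))

-- Record, for each leaf, the parity of the number of left edges on its path from the
-- root.  A 2-rotation ((t₀ ∧ t₁) ∧ t₂) ∧ t₃ ↦ t₀ ∧ ((t₁ ∧ t₂) ∧ t₃) lowers the left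
-- depth of the leaves of t₀ by two and leaves all others unchanged, so this parity word
-- is an invariant.  It is complete: rotating every tree into a right spine of right
-- combs, the lengths of the combs can be read off the word.  The word of a tree with
-- n + 1 ≥ 3 leaves always ends in true, false, and each of the 2^(n-1) choices of the
-- remaining n - 1 letters occurs.
module Submission where

open import Defs
open import Data.Bool using (Bool; true; false; not)
open import Data.Bool.Properties using (not-involutive)
open import Data.Fin using (Fin)
open import Data.Fin.Properties using (2↔Bool)
open import Data.List using (List; []; _∷_; _++_; [_]; length; map; replicate)
open import Data.List.Properties
  using ( ++-assoc; ++-cancelʳ; ∷-injectiveʳ; map-++; map-∘; map-cong; map-id
        ; length-++; length-++-comm; length-map)
open import Data.Nat using (ℕ; zero; suc; _+_; _≤_; _∸_; _^_)
open import Data.Nat.Properties using (suc-injective)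
open import Data.Product using (∃; _×_; _,_; proj₁; proj₂; map₁; uncurry)
open import Data.Vec using (Vec; toList; fromList)
open import Data.Vec.Properties using (toList-injective; cast-is-id; toList∘fromList; length-toList)
open import Data.Vec.Recursive using (lift↔; Fin[m^n]↔Fin[m]^n)
open import Data.Vec.Recursive.Properties using (↔Vec)
open import Function using (_∘_; id; _⇔_; mk⇔; _↔_; Inverse; Injection)
import Function.Properties.Equivalence as ⇔
open import Function.Properties.Inverse using (↔-trans; ↔-sym; ↔⇒↣)
open import Relation.Binary.PropositionalEquality
  using (_≡_; refl; sym; trans; cong; cong₂; isEquivalence; module ≡-Reasoning)
open import Relation.Binary.Construct.Closure.Equivalence as EqClosure using ()
open import Relation.Binary.Construct.Closure.ReflexiveTransitive using (ε; _◅◅_)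
import Relation.Binary.Reasoning.Setoid as SetoidReasoning

infix 4 _≈_
_≈_ : Tree → Tree → Set
s ≈ t = s ≈[ 2 ] t

module ≈-Reasoning = SetoidReasoning (EqClosure.setoid (RightRot 2))

≈-sym : ∀ {s t} → s ≈ t → t ≈ s
≈-sym = EqClosure.symmetric (RightRot 2)

∧-congˡ : ∀ {s s'} u → s ≈ s' → s ∧ u ≈ s' ∧ u
∧-congˡ u = EqClosure.gmap (_∧ u) (RightRot.left u)

∧-congʳ : ∀ s {t t'} → t ≈ t' → s ∧ t ≈ s ∧ t'
∧-congʳ s = EqClosure.gmap (s ∧_) (RightRot.right s)

rotate : ∀ t₀ t₁ t₂ t₃ → t₀ ∧ t₁ ∧ t₂ ∧ t₃ ≈ t₀ ∧ (t₁ ∧ t₂ ∧ t₃)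
rotate t₀ t₁ t₂ t₃ = EqClosure.return (root t₀ t₁ (t₂ ∷ []) t₃ refl)

parities : Tree → List Bool
parities leaf    = [ false ]
parities (s ∧ t) = map not (parities s) ++ parities t

map-not-involutive : ∀ xs → map not (map not xs) ≡ xs
map-not-involutive xs = begin
  map not (map not xs) ≡⟨ map-∘ xs ⟨
  map (not ∘ not) xs   ≡⟨ map-cong not-involutive xs ⟩
  map id xs            ≡⟨ map-id xs ⟩
  xs                   ∎
  where open ≡-Reasoning

parities-∧∧ : ∀ s t u → parities (s ∧ t ∧ u) ≡ parities s ++ map not (parities t) ++ parities u
parities-∧∧ s t u = begin
  map not (map not ps ++ pt) ++ pu           ≡⟨ cong (_++ pu) (map-++ not (map not ps) pt) ⟩
  (map not (map not ps) ++ map not pt) ++ pu ≡⟨ cong (λ xs → (xs ++ map not pt) ++ pu) (map-not-involutive ps) ⟩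
  (ps ++ map not pt) ++ pu                   ≡⟨ ++-assoc ps (map not pt) pu ⟩
  ps ++ map not pt ++ pu                     ∎
  where
  open ≡-Reasoning
  ps = parities s
  pt = parities t
  pu = parities u

parities-rotate : ∀ {s t} → RightRot 2 s t → parities s ≡ parities t
parities-rotate (root t₀ t₁ (t₂ ∷ []) t₃ refl) = begin
  parities (t₀ ∧ t₁ ∧ t₂ ∧ t₃)              ≡⟨ parities-∧∧ (t₀ ∧ t₁) t₂ t₃ ⟩
  (map not p₀ ++ p₁) ++ map not p₂ ++ p₃    ≡⟨ ++-assoc (map not p₀) p₁ (map not p₂ ++ p₃) ⟩
  map not p₀ ++ p₁ ++ map not p₂ ++ p₃      ≡⟨ cong (map not p₀ ++_) (parities-∧∧ t₁ t₂ t₃) ⟨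
  parities (t₀ ∧ (t₁ ∧ t₂ ∧ t₃))            ∎
  where
  open ≡-Reasoning
  p₀ = parities t₀
  p₁ = parities t₁
  p₂ = parities t₂
  p₃ = parities t₃
parities-rotate (left u r)  = cong (λ xs → map not xs ++ parities u) (parities-rotate r)
parities-rotate (right s r) = cong (map not (parities s) ++_) (parities-rotate r)

≈⇒parities≡ : ∀ {s t} → s ≈ t → parities s ≡ parities t
≈⇒parities≡ = EqClosure.gfold isEquivalence parities parities-rotate

rightComb : ℕ → Tree → Tree
rightComb zero    t = t
rightComb (suc k) t = leaf ∧ rightComb k t

-- canonical (k₁ ∷ ⋯ ∷ kᵣ ∷ []) = R k₁ ∧ (R k₂ ∧ ⋯ (R kᵣ ∧ leaf)), where R k is the right comb
-- with k + 1 leaves; every tree is equivalent to exactly one of these.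
canonical : List ℕ → Tree
canonical []       = leaf
canonical (k ∷ ks) = rightComb k leaf ∧ canonical ks

pushLeaf : Tree → Tree
pushLeaf leaf    = leaf
pushLeaf (s ∧ t) = (leaf ∧ s) ∧ t

incHead : List ℕ → List ℕ
incHead []       = []
incHead (k ∷ ks) = suc k ∷ ks

canonical-incHead : ∀ ks → canonical (incHead ks) ≡ pushLeaf (canonical ks)
canonical-incHead []      = refl
canonical-incHead (_ ∷ _) = refl

canonical-zeros : ∀ k ks → canonical (replicate k 0 ++ ks) ≡ rightComb k (canonical ks)
canonical-zeros zero    ks = refl
canonical-zeros (suc k) ks = cong (leaf ∧_) (canonical-zeros k ks)

pushLeaf-rotate : ∀ {s t} → RightRot 2 s t → pushLeaf s ≈ pushLeaf t
pushLeaf-rotate (root t₀ t₁ (t₂ ∷ []) t₃ refl) =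
  ∧-congˡ t₃ (≈-sym (rotate leaf t₀ t₁ t₂)) ◅◅ rotate (leaf ∧ t₀) t₁ t₂ t₃
pushLeaf-rotate (left u r)  = ∧-congˡ u (∧-congʳ leaf (EqClosure.return r))
pushLeaf-rotate (right s r) = ∧-congʳ (leaf ∧ s) (EqClosure.return r)

pushLeaf-cong : ∀ {s t} → s ≈ t → pushLeaf s ≈ pushLeaf t
pushLeaf-cong = EqClosure.gfold (EqClosure.isEquivalence (RightRot 2)) pushLeaf pushLeaf-rotate

rightComb-cong : ∀ k {s t} → s ≈ t → rightComb k s ≈ rightComb k t
rightComb-cong zero    = id
rightComb-cong (suc k) = ∧-congʳ leaf ∘ rightComb-cong k

rightComb-pushLeaf : ∀ k s t → rightComb k leaf ∧ s ∧ t ≈ rightComb k (pushLeaf (s ∧ t))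
rightComb-pushLeaf zero    s t = ε
rightComb-pushLeaf (suc k) s t =
  rotate leaf (rightComb k leaf) s t ◅◅ ∧-congʳ leaf (rightComb-pushLeaf k s t)

joinBlocks : List ℕ → List ℕ → List ℕ
joinBlocks []       ks = 0 ∷ ks
joinBlocks (k ∷ as) ks = replicate k 0 ++ incHead (joinBlocks as ks)

canonical-join : ∀ as ks → canonical as ∧ canonical ks ≈ canonical (joinBlocks as ks)
canonical-join []       ks = ε
canonical-join (k ∷ as) ks = begin
  rightComb k leaf ∧ canonical as ∧ canonical ks
    ≈⟨ rightComb-pushLeaf k (canonical as) (canonical ks) ⟩
  rightComb k (pushLeaf (canonical as ∧ canonical ks))
    ≈⟨ rightComb-cong k (pushLeaf-cong (canonical-join as ks)) ⟩
  rightComb k (pushLeaf (canonical (joinBlocks as ks)))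
    ≡⟨ cong (rightComb k) (canonical-incHead (joinBlocks as ks)) ⟨
  rightComb k (canonical (incHead (joinBlocks as ks)))
    ≡⟨ canonical-zeros k (incHead (joinBlocks as ks)) ⟨
  canonical (joinBlocks (k ∷ as) ks)
    ∎
  where open ≈-Reasoning

normalise : Tree → List ℕ
normalise leaf    = []
normalise (s ∧ t) = joinBlocks (normalise s) (normalise t)

≈-normalise : ∀ t → t ≈ canonical (normalise t)
≈-normalise leaf    = ε
≈-normalise (s ∧ t) =
  ∧-congˡ t (≈-normalise s) ◅◅ ∧-congʳ _ (≈-normalise t) ◅◅ canonical-join (normalise s) (normalise t)

blockWord : List ℕ → List Bool
blockWord []       = [ false ]
blockWord (k ∷ ks) = replicate k false ++ true ∷ blockWord ks

not-parities-rightComb : ∀ k → map not (parities (rightComb k leaf)) ≡ replicate k false ++ [ true ]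
not-parities-rightComb zero    = refl
not-parities-rightComb (suc k) = cong (false ∷_) (not-parities-rightComb k)

parities-canonical : ∀ ks → parities (canonical ks) ≡ blockWord ks
parities-canonical []       = refl
parities-canonical (k ∷ ks) = begin
  map not (parities (rightComb k leaf)) ++ parities (canonical ks)
    ≡⟨ cong₂ _++_ (not-parities-rightComb k) (parities-canonical ks) ⟩
  (replicate k false ++ [ true ]) ++ blockWord ks
    ≡⟨ ++-assoc (replicate k false) [ true ] (blockWord ks) ⟩
  blockWord (k ∷ ks)
    ∎
  where open ≡-Reasoning

block-injective : ∀ k l {xs ys} →
                  replicate k false ++ true ∷ xs ≡ replicate l false ++ true ∷ ys → k ≡ l × xs ≡ ys
block-injective zero    zero    refl = refl , refl
block-injective (suc k) (suc l) eq   = map₁ (cong suc) (block-injective k l (∷-injectiveʳ eq))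

blockWord-injective : ∀ ks ls → blockWord ks ≡ blockWord ls → ks ≡ ls
blockWord-injective []       []       _  = refl
blockWord-injective (k ∷ ks) (l ∷ ls) eq with block-injective k l eq
... | refl , eq′ = cong (k ∷_) (blockWord-injective ks ls eq′)
blockWord-injective []                (zero ∷ _)          ()
blockWord-injective []                (suc zero ∷ _)      ()
blockWord-injective []                (suc (suc _) ∷ _)   ()
blockWord-injective (zero ∷ _)        []                  ()
blockWord-injective (suc zero ∷ _)    []                  ()
blockWord-injective (suc (suc _) ∷ _) []                  ()

blockWord-normalise : ∀ t → blockWord (normalise t) ≡ parities t
blockWord-normalise t =
  trans (sym (parities-canonical (normalise t))) (sym (≈⇒parities≡ (≈-normalise t)))

parities≡⇒≈ : ∀ {s t} → parities s ≡ parities t → s ≈ t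
parities≡⇒≈ {s} {t} eq = begin
  s                        ≈⟨ ≈-normalise s ⟩
  canonical (normalise s)  ≡⟨ cong canonical normalise≡ ⟩
  canonical (normalise t)  ≈⟨ ≈-normalise t ⟨
  t                        ∎
  where
  open ≈-Reasoning
  normalise≡ : normalise s ≡ normalise t
  normalise≡ = blockWord-injective (normalise s) (normalise t)
    (trans (blockWord-normalise s) (trans eq (sym (blockWord-normalise t))))

≈⇔parities≡ : ∀ {s t} → s ≈ t ⇔ parities s ≡ parities t
≈⇔parities≡ = mk⇔ ≈⇒parities≡ parities≡⇒≈

length-parities : ∀ t → length (parities t) ≡ leaves t
length-parities leaf    = refl
length-parities (s ∧ t) = begin
  length (map not (parities s) ++ parities t)         ≡⟨ length-++ (map not (parities s)) ⟩
  length (map not (parities s)) + length (parities t) ≡⟨ cong (_+ length (parities t)) (length-map not (parities s)) ⟩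
  length (parities s) + length (parities t)           ≡⟨ cong₂ _+_ (length-parities s) (length-parities t) ⟩
  leaves s + leaves t                                 ∎
  where open ≡-Reasoning

trueFalse : List Bool
trueFalse = true ∷ false ∷ []

parities-snoc-false : ∀ t → ∃ λ xs → parities t ≡ xs ++ [ false ]
parities-snoc-false leaf    = [] , refl
parities-snoc-false (s ∧ t) with parities-snoc-false t
... | xs , eq = map not (parities s) ++ xs ,
  trans (cong (map not (parities s) ++_) eq) (sym (++-assoc (map not (parities s)) xs [ false ]))

parities-∧-snoc-trueFalse : ∀ s t → ∃ λ xs → parities (s ∧ t) ≡ xs ++ trueFalse
parities-∧-snoc-trueFalse s leaf with parities-snoc-false s
... | xs , eq = map not xs , (begin
  map not (parities s) ++ [ false ]        ≡⟨ cong (λ ys → map not ys ++ [ false ]) eq ⟩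
  map not (xs ++ [ false ]) ++ [ false ]   ≡⟨ cong (_++ [ false ]) (map-++ not xs [ false ]) ⟩
  (map not xs ++ [ true ]) ++ [ false ]    ≡⟨ ++-assoc (map not xs) [ true ] [ false ] ⟩
  map not xs ++ trueFalse                  ∎)
  where open ≡-Reasoning
parities-∧-snoc-trueFalse s (t ∧ u) with parities-∧-snoc-trueFalse t u
... | xs , eq = map not (parities s) ++ xs ,
  trans (cong (map not (parities s) ++_) eq) (sym (++-assoc (map not (parities s)) xs trueFalse))

toList-surjective : ∀ {a} {A : Set a} {m} (xs : List A) → length xs ≡ m →
                    ∃ λ (v : Vec A m) → toList v ≡ xs
toList-surjective xs refl = fromList xs , toList∘fromList xs

toList-++ʳ-injective : ∀ {a} {A : Set a} {m} zs {v w : Vec A m} → toList v ++ zs ≡ toList w ++ zs → v ≡ w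
toList-++ʳ-injective zs {v} {w} eq =
  trans (sym (cast-is-id refl v)) (toList-injective refl v w (++-cancelʳ zs (toList v) (toList w) eq))

length-prefix : ∀ {m} t {xs} → leaves t ≡ suc (suc m) → parities t ≡ xs ++ trueFalse → length xs ≡ m
length-prefix t {xs} leaves≡ eq = suc-injective (suc-injective (begin
  suc (suc (length xs))    ≡⟨ length-++-comm xs trueFalse ⟨
  length (xs ++ trueFalse) ≡⟨ cong length eq ⟨
  length (parities t)      ≡⟨ length-parities t ⟩
  leaves t                 ≡⟨ leaves≡ ⟩
  _                        ∎))
  where open ≡-Reasoning

parities-𝒯 : ∀ {m} (t : 𝒯 (suc m)) → ∃ λ (v : Vec Bool m) → parities (proj₁ t) ≡ toList v ++ trueFalse
parities-𝒯 (s ∧ t , leaves≡) =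
  let xs , eq        = parities-∧-snoc-trueFalse s t
      v  , toList-v≡ = toList-surjective xs (length-prefix (s ∧ t) leaves≡ eq)
  in  v , trans eq (cong (_++ trueFalse) (sym toList-v≡))

word : ∀ {m} → 𝒯 (suc m) → Vec Bool m
word = proj₁ ∘ parities-𝒯

word-unique : ∀ {m} (t : 𝒯 (suc m)) {v} → parities (proj₁ t) ≡ toList v ++ trueFalse → word t ≡ v
word-unique t eq = toList-++ʳ-injective trueFalse (trans (sym (proj₂ (parities-𝒯 t))) eq)

word≡⇔parities≡ : ∀ {m} (s t : 𝒯 (suc m)) → word s ≡ word t ⇔ parities (proj₁ s) ≡ parities (proj₁ t)
word≡⇔parities≡ s t = mk⇔
  (λ eq → trans parities-s (trans (cong (λ v → toList v ++ trueFalse) eq) (sym parities-t)))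
  (λ eq → word-unique s (trans eq parities-t))
  where
  parities-s = proj₂ (parities-𝒯 s)
  parities-t = proj₂ (parities-𝒯 t)

-- Returns the two children of the tree, so that prepending false (a leaf pushed onto the
-- left child, as in pushLeaf) is structural.
realise : List Bool → Tree × Tree
realise []           = leaf , leaf
realise (true ∷ xs)  = leaf , uncurry _∧_ (realise xs)
realise (false ∷ xs) = map₁ (leaf ∧_) (realise xs)

parities-realise : ∀ xs → parities (uncurry _∧_ (realise xs)) ≡ xs ++ trueFalse
parities-realise []           = refl
parities-realise (true ∷ xs)  = cong (true ∷_) (parities-realise xs)
parities-realise (false ∷ xs) = cong (false ∷_) (parities-realise xs)

word-surjective : ∀ {m} (v : Vec Bool m) → ∃ λ (t : 𝒯 (suc m)) → word t ≡ v
word-surjective {m} v = (tree , leaves≡) , word-unique (tree , leaves≡) (parities-realise (toList v))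
  where
  tree = uncurry _∧_ (realise (toList v))
  leaves≡ : leaves tree ≡ suc (suc m)
  leaves≡ = begin
    leaves tree                     ≡⟨ length-parities tree ⟨
    length (parities tree)          ≡⟨ cong length (parities-realise (toList v)) ⟩
    length (toList v ++ trueFalse)  ≡⟨ length-++-comm (toList v) trueFalse ⟩
    suc (suc (length (toList v)))   ≡⟨ cong (suc ∘ suc) (length-toList v) ⟩
    suc (suc m)                     ∎
    where open ≡-Reasoning

bits : ∀ m → Vec Bool m ↔ Fin (2 ^ m)
bits m = ↔-sym (↔-trans (Fin[m^n]↔Fin[m]^n 2 m) (↔-trans (lift↔ m 2↔Bool) (↔Vec m)))

proposition2p12 : (n : ℕ) → 1 ≤ n → HasClassCount 2 n (2 ^ (n ∸ 1))
proposition2p12 (suc m) _ = class , class-surjective , class≡⇔≈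
  where
  open Inverse (bits m) using (to; from; strictlyInverseˡ)

  class : 𝒯 (suc m) → Fin (2 ^ m)
  class = to ∘ word

  class-surjective : ∀ i → ∃ λ t → class t ≡ i
  class-surjective i =
    let t , word-t≡ = word-surjective (from i) in t , trans (cong to word-t≡) (strictlyInverseˡ i)

  class≡⇔≈ : ∀ s t → class s ≡ class t ⇔ proj₁ s ≈ proj₁ t
  class≡⇔≈ s t =
    ⇔.trans (mk⇔ (Injection.injective (↔⇒↣ (bits m))) (cong to))
            (⇔.trans (word≡⇔parities≡ s t) (⇔.sym ≈⇔parities≡))
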